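{- Let $\mathbb{X}=\langle\omega,\rho\rangle$ be a countable binary relational structure. Then: (a) either $\mathbb{P}(\mathbb{X})=[\omega]^\omega$ or $\mathbb{P}(\mathbb{X})$ is nowhere dense in $\langle[\omega]^\omega,\subseteq\rangle$; (b) if $\mathbb{X}$ is indivisible, then either $\mathcal{I}_{\mathbb{X}}=\mathrm{Fin}$ or $\mathcal{I}_{\mathbb{X}}$ is a tall ideal, i.e. for every $S\in[\omega]^\omega$ there is $I\in\mathcal{I}_{\mathbb{X}}\cap[S]^\omega$.
   Context: $\mathbb{P}(\mathbb{X})$ is the set of all $A\subseteq\omega$ with $\langle A,\rho\cap A^2\rangle\cong\mathbb{X}$; $\mathcal{I}_{\mathbb{X}}=\{I\subseteq\omega:\neg\exists A\in\mathbb{P}(\mathbb{X})\ A\subseteq I\}$; $\mathrm{Fin}$ is the ideal of finite subsets of $\omega$; $[S]^\omega$ is the set of infinite subsets of $S$. A set $S$ is nowhere dense in $\langle P,\le\rangle$ iff there is no $p\in P$ such that every $q\le p$ has some $s\in S$ with $s\le q$. $\mathbb{X}$ is indivisible iff for every partition $\omega=A\cup B$, $\mathbb{X}$ embeds into the substructure on $A$ or on $B$. -}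

module Defs where

open import Level using (0ℓ)
open import Data.Nat using (ℕ; _≤_; _<_)
open import Data.Product using (Σ; ∃; _×_; _,_)
open import Data.Sum using (_⊎_)
open import Data.Empty using (⊥)
open import Relation.Nullary using (¬_)
open import Relation.Unary using (Pred; _∈_; _⊆_)
open import Relation.Binary using (Rel)
open import Relation.Binary.PropositionalEquality using (_≡_)
open import Function.Bundles using (_⇔_)
open import Function.Definitions using (Injective)

-- Subsets of ω are predicates on ℕ; a binary structure X = ⟨ω, ρ⟩ is given by ρ.
Subset : Set₁
Subset = Pred ℕ 0ℓ

Infinite : Subset → Set
Infinite A = ∀ n → ∃ λ m → n ≤ m × m ∈ A

Finite : Subset → Set
Finite A = ∃ λ n → ∀ m → m ∈ A → m < n

IsEmbedding : Rel ℕ 0ℓ → (ℕ → ℕ) → Set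
IsEmbedding ρ f = Injective _≡_ _≡_ f × (∀ x y → ρ x y ⇔ ρ (f x) (f y))

EmbedsInto : Rel ℕ 0ℓ → Subset → Set
EmbedsInto ρ A = Σ (ℕ → ℕ) λ f → IsEmbedding ρ f × (∀ n → f n ∈ A)

-- A ∈ ℙ(X): ⟨A, ρ ∩ A²⟩ ≅ X, i.e. an embedding of X whose image is exactly A
ℙ : Rel ℕ 0ℓ → Subset → Set
ℙ ρ A = Σ (ℕ → ℕ) λ f → IsEmbedding ρ f × (∀ a → a ∈ A ⇔ (∃ λ n → f n ≡ a))

𝓘 : Rel ℕ 0ℓ → Subset → Set₁
𝓘 ρ I = ¬ (Σ Subset λ A → ℙ ρ A × A ⊆ I)

NowhereDense : (Subset → Set) → Set₁
NowhereDense S =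
  ¬ (Σ Subset λ p → Infinite p ×
       (∀ q → Infinite q → q ⊆ p → Σ Subset λ s → S s × s ⊆ q))

IsPartition : Subset → Subset → Set
IsPartition A B = (∀ n → n ∈ A ⊎ n ∈ B) × (∀ n → n ∈ A → n ∈ B → ⊥)

Indivisible : Rel ℕ 0ℓ → Set₁
Indivisible ρ = ∀ A B → IsPartition A B → EmbedsInto ρ A ⊎ EmbedsInto ρ B

Tall : (Subset → Set₁) → Set₁
Tall 𝓙 = ∀ S → Infinite S → Σ Subset λ I → 𝓙 I × Infinite I × I ⊆ S

-- If ℙ(X) is not nowhere dense, some infinite p contains a copy of X inside each of its
-- infinite subsets. By Ramsey's theorem p has an infinite subset q on which ρ a b depends
-- only on the order type of (a, b). A copy g of X inside q then shows that ρ x y depends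
-- only on the order type of (g x, g y). For an infinite A, the order isomorphism between
-- the ranges of g on ω and on A, pulled back along g, is an isomorphism of X onto A.
-- Part (b) follows from (a): if every infinite set is a copy then 𝓘 = Fin, and if ℙ(X)
-- is nowhere dense then every infinite S has an infinite subset containing no copy.
module Submission where

open import Defs
open import Axiom.ExcludedMiddle using (ExcludedMiddle)
open import Axiom.DoubleNegationElimination using (DoubleNegationElimination; em⇒dne)
open import Data.Bool using (Bool; true; false)
open import Data.Bool.Properties using (¬-not)
open import Data.Empty using (⊥-elim)
open import Data.Fin using (Fin; toℕ; fromℕ<)
open import Data.Fin.Properties as Finₚ using (toℕ-fromℕ<; toℕ-injective; pigeonhole)
open import Data.Nat using (ℕ; zero; suc; _≤_; _<_; _≤′_; ≤′-refl; ≤′-step; z≤n; s≤s; _⊔_)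
open import Data.Nat.Properties
open import Data.Product as Product using (Σ; ∃; _×_; _,_; proj₁; proj₂)
open import Data.Sum as Sum using (_⊎_; inj₁; inj₂)
open import Data.Unit using (tt)
open import Function.Base using (_∘_; flip)
open import Function.Bundles using (_⇔_; mk⇔; Equivalence)
open import Function.Definitions using (Injective)
open import Level using (0ℓ; Lift; lift; lower)
open import Relation.Binary using (Rel; tri<; tri≈; tri>)
open import Relation.Binary.PropositionalEquality
open import Relation.Nullary using (¬_; Dec; yes; no; does; contradiction)
open import Relation.Nullary.Decidable using (map′; dec-true; decidable-stable)
open import Relation.Unary using (U; Decidable; _⊆_)

open Equivalence using (to; from)

private
  variable
    m n m′ n′ d d′ : ℕ
    A D : Subset

data Order : Set where
  less equal greater : Order

order : ℕ → ℕ → Order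
order zero    zero    = equal
order zero    (suc _) = less
order (suc _) zero    = greater
order (suc m) (suc n) = order m n

order-< : m < n → order m n ≡ less
order-< {zero}  {suc n} _         = refl
order-< {suc m} {suc n} (s≤s m<n) = order-< m<n

order-> : ∀ {m n} → n < m → order m n ≡ greater
order-> {suc m} {zero}  _         = refl
order-> {suc m} {suc n} (s≤s n<m) = order-> n<m

order-refl : ∀ n → order n n ≡ equal
order-refl zero    = refl
order-refl (suc n) = order-refl n

order-equal⇒≡ : order m n ≡ equal → m ≡ n
order-equal⇒≡ {zero}  {zero}  _ = refl
order-equal⇒≡ {suc m} {suc n} e = cong suc (order-equal⇒≡ e)

order-≡⇒≡ : order m n ≡ order m′ n′ → m ≡ n → m′ ≡ n′
order-≡⇒≡ {m} e refl = order-equal⇒≡ (trans (sym e) (order-refl m))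

strictMonoOn⇒order-preserving : ∀ {D : Subset} {σ : ℕ → ℕ} →
  (∀ {x y} → D x → D y → x < y → σ x < σ y) →
  ∀ {d d′} → D d → D d′ → order (σ d) (σ d′) ≡ order d d′
strictMonoOn⇒order-preserving {σ = σ} mono {d} {d′} x x′ with <-cmp d d′
... | tri< d<d′ _ _ = trans (order-< (mono x x′ d<d′)) (sym (order-< d<d′))
... | tri≈ _ refl _ = trans (order-refl (σ d)) (sym (order-refl d))
... | tri> _ _ d′<d = trans (order-> (mono x′ x d′<d)) (sym (order-> d′<d))

OrderInvariantOn : Rel ℕ 0ℓ → Subset → Set
OrderInvariantOn ρ q = ∀ {a b a′ b′} → q a → q b → q a′ → q b′ →
  order a b ≡ order a′ b′ → ρ a b → ρ a′ b′

OrderDeterminedBy : Rel ℕ 0ℓ → (ℕ → ℕ) → Set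
OrderDeterminedBy ρ g = ∀ {x y x′ y′} →
  order (g x) (g y) ≡ order (g x′) (g y′) → ρ x y → ρ x′ y′

OrderColoured : (ℕ → ℕ → Bool) → Subset → Set
OrderColoured c q = Σ (Order → Bool) λ H → ∀ {a b} → q a → q b → c a b ≡ H (order a b)

embedding-into-invariant⇒determined : {ρ : Rel ℕ 0ℓ} {g : ℕ → ℕ} {q : Subset} →
  IsEmbedding ρ g → (∀ n → q (g n)) → OrderInvariantOn ρ q → OrderDeterminedBy ρ g
embedding-into-invariant⇒determined (_ , g-ρ) g∈q inv {x} {y} {x′} {y′} e r =
  from (g-ρ x′ y′) (inv (g∈q x) (g∈q y) (g∈q x′) (g∈q y′) e (to (g-ρ x y) r))

U-infinite : Infinite U
U-infinite n = n , ≤-refl , tt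

Image : (ℕ → ℕ) → Subset → Subset
Image h A b = ∃ λ a → A a × h a ≡ b

-- h restricted to Fin (suc n) would be an injection into Fin n
bounded⇒¬injective : (h : ℕ → ℕ) → (∀ k → h k < n) → ¬ Injective _≡_ _≡_ h
bounded⇒¬injective {n} h below h-inj
  with pigeonhole ≤-refl (λ (i : Fin (suc n)) → fromℕ< (below (toℕ i)))
... | i , j , i<j , collision = Finₚ.<⇒≢ i<j (toℕ-injective (h-inj (begin
  h (toℕ i)                     ≡⟨ toℕ-fromℕ< (below (toℕ i)) ⟨
  toℕ (fromℕ< (below (toℕ i)))  ≡⟨ cong toℕ collision ⟩
  toℕ (fromℕ< (below (toℕ j)))  ≡⟨ toℕ-fromℕ< (below (toℕ j)) ⟩
  h (toℕ j)                     ∎)))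
  where open ≡-Reasoning

Finite⇒¬Infinite : Finite A → ¬ Infinite A
Finite⇒¬Infinite (N , bound) A-inf with A-inf N
... | m , N≤m , m∈A = ≤⇒≯ N≤m (bound m m∈A)

module Rank (D? : Decidable D) (D-inf : Infinite D) where

  rank : ℕ → ℕ
  rank zero = zero
  rank (suc n) with D? n
  ... | yes _ = suc (rank n)
  ... | no  _ = rank n

  rank-step : ∀ n → rank n ≤ rank (suc n)
  rank-step n with D? n
  ... | yes _ = n≤1+n _
  ... | no  _ = ≤-refl

  rank-mono′ : m ≤′ n → rank m ≤ rank n
  rank-mono′ ≤′-refl             = ≤-refl
  rank-mono′ (≤′-step {n} m≤′n) = ≤-trans (rank-mono′ m≤′n) (rank-step n)

  rank-mono : m ≤ n → rank m ≤ rank n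
  rank-mono = rank-mono′ ∘ ≤⇒≤′

  rank-suc-∈ : D n → rank (suc n) ≡ suc (rank n)
  rank-suc-∈ {n} n∈D with D? n
  ... | yes _  = refl
  ... | no n∉D = contradiction n∈D n∉D

  rank-strict : D m → m < n → rank m < rank n
  rank-strict {m} {n} m∈D m<n = subst (_≤ rank n) (rank-suc-∈ m∈D) (rank-mono m<n)

  rank-injective : D m → D n → rank m ≡ rank n → m ≡ n
  rank-injective {m} {n} m∈D n∈D e with <-cmp m n
  ... | tri< m<n _ _ = contradiction e (<⇒≢ (rank-strict m∈D m<n))
  ... | tri≈ _ m≡n _ = m≡n
  ... | tri> _ _ n<m = contradiction (sym e) (<⇒≢ (rank-strict n∈D n<m))

  rank-unbounded : ∀ k → ∃ λ n → k ≤ rank n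
  rank-unbounded zero = zero , z≤n
  rank-unbounded (suc k) with rank-unbounded k
  ... | N , k≤rN with D-inf N
  ... | m , N≤m , m∈D =
    suc m , subst (suc k ≤_) (sym (rank-suc-∈ m∈D)) (s≤s (≤-trans k≤rN (rank-mono N≤m)))

  -- rank grows by at most one per step, so it attains every value below rank n
  rank-attains : ∀ n {k} → k < rank n → ∃ λ d → D d × rank d ≡ k
  rank-attains (suc n) k<r with D? n
  ... | no _ = rank-attains n k<r
  ... | yes n∈D with m<1+n⇒m<n∨m≡n k<r
  ...   | inj₁ k<rn = rank-attains n k<rn
  ...   | inj₂ k≡rn = n , n∈D , sym k≡rn

  -- opaque: Agda would otherwise unfold this proof during unification and run out of memory
  opaque
    rank-onto : ∀ k → ∃ λ d → D d × rank d ≡ k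
    rank-onto k = rank-attains (proj₁ (rank-unbounded (suc k))) (proj₂ (rank-unbounded (suc k)))

  enum : ℕ → ℕ
  enum k = proj₁ (rank-onto k)

  enum-∈ : ∀ k → D (enum k)
  enum-∈ k = proj₁ (proj₂ (rank-onto k))

  rank-enum : ∀ k → rank (enum k) ≡ k
  rank-enum k = proj₂ (proj₂ (rank-onto k))

  enum-rank : D d → enum (rank d) ≡ d
  enum-rank {d} d∈D = rank-injective (enum-∈ (rank d)) d∈D (rank-enum (rank d))

  enum-strict : ∀ {k k′} → k < k′ → enum k < enum k′
  enum-strict {k} {k′} k<k′ = ≰⇒> λ enum-k′≤enum-k →
    <⇒≱ k<k′ (subst₂ _≤_ (rank-enum k′) (rank-enum k) (rank-mono enum-k′≤enum-k))

  enum-injective : Injective _≡_ _≡_ enum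
  enum-injective {k} {k′} e = trans (sym (rank-enum k)) (trans (cong rank e) (rank-enum k′))

lower-em : ∀ {ℓ} → ExcludedMiddle (Level.suc ℓ) → ExcludedMiddle ℓ
lower-em em = map′ lower lift em

does-true⇒ : {P : Set} (P? : Dec P) → does P? ≡ true → P
does-true⇒ (yes p) _ = p

SomewhereDense : (Subset → Set) → Set₁
SomewhereDense S =
  Σ Subset λ p → Infinite p × (∀ q → Infinite q → q ⊆ p → Σ Subset λ s → S s × s ⊆ q)

module Classical (em : ExcludedMiddle 0ℓ) where

  decidable : (P : Subset) → Decidable P
  decidable P n = em

  ¬Finite⇒Infinite : ¬ Finite A → Infinite A
  ¬Finite⇒Infinite {A} ¬fin n with em {∃ λ m → n ≤ m × A m}
  ... | yes found = found
  ... | no ¬found = contradiction (n , λ m m∈A → ≰⇒> λ n≤m → ¬found (m , n≤m , m∈A)) ¬fin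

  injective⇒unbounded : (h : ℕ → ℕ) → Injective _≡_ _≡_ h → ∀ n → ∃ λ k → n ≤ h k
  injective⇒unbounded h h-inj n with em {∃ λ k → n ≤ h k}
  ... | yes found = found
  ... | no ¬found = ⊥-elim (bounded⇒¬injective h (λ k → ≰⇒> λ n≤hk → ¬found (k , n≤hk)) h-inj)

  image-infinite : {h : ℕ → ℕ} → Injective _≡_ _≡_ h → Infinite A → Infinite (Image h A)
  image-infinite {A} {h} h-inj A-inf n =
    Product.map (h ∘ enum) (λ {k} n≤h → n≤h , enum k , enum-∈ k , refl)
      (injective⇒unbounded (h ∘ enum) (enum-injective ∘ h-inj) n)
    where open Rank (decidable A) A-inf

  ℙ⇒Infinite : {ρ : Rel ℕ 0ℓ} → ℙ ρ A → Infinite A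
  ℙ⇒Infinite (f , (f-inj , _) , f-onto) n with injective⇒unbounded f f-inj n
  ... | k , n≤fk = f k , n≤fk , from (f-onto (f k)) (k , refl)

  infinite-pigeonhole : {T : Subset} (χ : ℕ → Bool) → Infinite T →
    ∃ λ β → Infinite (λ n → T n × χ n ≡ β)
  infinite-pigeonhole {T} χ T-inf with em {Infinite (λ n → T n × χ n ≡ true)}
  ... | yes inf-true = true , inf-true
  ... | no ¬inf-true = false , inf-false
    where
    -- if χ were true on T from n on, T ∩ χ⁻¹(true) would be infinite
    inf-false : Infinite (λ n → T n × χ n ≡ false)
    inf-false n with em {∃ λ m → n ≤ m × T m × χ m ≡ false}
    ... | yes found = found
    ... | no ¬found = contradiction inf-true ¬inf-true
      where
      inf-true : Infinite (λ n → T n × χ n ≡ true)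
      inf-true k with T-inf (n ⊔ k)
      ... | m , n⊔k≤m , m∈T = m , ≤-trans (m≤n⊔m n k) n⊔k≤m , m∈T ,
        ¬-not λ χm≡false → ¬found (m , ≤-trans (m≤m⊔n n k) n⊔k≤m , m∈T , χm≡false)

  module Ramsey (c : ℕ → ℕ → Bool) where

    Stage : Set₁
    Stage = Σ Subset Infinite

    head : Stage → ℕ
    head (S , S-inf) = proj₁ (S-inf 0)

    head-∈ : (s : Stage) → proj₁ s (head s)
    head-∈ (S , S-inf) = proj₂ (proj₂ (S-inf 0))

    Above : ℕ → Subset → Subset
    Above a S b = S b × a < b

    above-infinite : ∀ {S} a → Infinite S → Infinite (Above a S)
    above-infinite a S-inf n with S-inf (n ⊔ suc a)
    ... | m , n⊔a<m , m∈S =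
      m , ≤-trans (m≤m⊔n n _) n⊔a<m , m∈S , ≤-trans (m≤n⊔m n _) n⊔a<m

    split : (s : Stage) →
      ∃ λ β → Infinite (λ b → Above (head s) (proj₁ s) b × c (head s) b ≡ β)
    split s = infinite-pigeonhole (c (head s)) (above-infinite (head s) (proj₂ s))

    colour : Stage → Bool
    colour s = proj₁ (split s)

    next : Stage → Stage
    next s = _ , proj₂ (split s)

    stage : Stage → ℕ → Stage
    stage s zero    = s
    stage s (suc i) = next (stage s i)

    module _ {p : Subset} (p-inf : Infinite p) where

      s₀ : Stage
      s₀ = p , p-inf

      a : ℕ → ℕ
      a i = head (stage s₀ i)

      stage-antitone : ∀ {i j} → i ≤′ j → proj₁ (stage s₀ j) ⊆ proj₁ (stage s₀ i)
      stage-antitone ≤′-refl        x∈S = x∈S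
      stage-antitone (≤′-step i≤′j) ((x∈S , _) , _) = stage-antitone i≤′j x∈S

      a-increasing×coloured : ∀ {i j} → i < j → a i < a j × c (a i) (a j) ≡ colour (stage s₀ i)
      a-increasing×coloured {j = j} i<j with stage-antitone (≤⇒≤′ i<j) (head-∈ (stage s₀ j))
      ... | (_ , ai<aj) , coloured = ai<aj , coloured

      a-≥ : ∀ i → i ≤ a i
      a-≥ zero    = z≤n
      a-≥ (suc i) = ≤-<-trans (a-≥ i) (proj₁ (a-increasing×coloured (n<1+n i)))

      ramsey : Σ Subset λ q → Infinite q × q ⊆ p ×
        Σ Bool λ β → ∀ {x y} → q x → q y → x < y → c x y ≡ β
      ramsey with infinite-pigeonhole (colour ∘ stage s₀) U-infinite
      ... | β , β-inf = q , q-inf , q⊆p , β , monochromatic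
        where
        -- the heads whose colour towards all later heads is β, a colour taken infinitely often
        q : Subset
        q x = ∃ λ i → colour (stage s₀ i) ≡ β × a i ≡ x

        q-inf : Infinite q
        q-inf n with β-inf n
        ... | i , n≤i , _ , coloured = a i , ≤-trans n≤i (a-≥ i) , i , coloured , refl

        q⊆p : q ⊆ p
        q⊆p (i , _ , refl) = stage-antitone {0} {i} (≤⇒≤′ z≤n) (head-∈ (stage s₀ i))

        monochromatic : ∀ {x y} → q x → q y → x < y → c x y ≡ β
        monochromatic (i , coloured , refl) (j , _ , refl) x<y with <-cmp i j
        ... | tri< i<j _ _ = trans (proj₂ (a-increasing×coloured i<j)) coloured
        ... | tri≈ _ refl _ = contradiction refl (<⇒≢ x<y)
        ... | tri> _ _ j<i = contradiction x<y (<-asym (proj₁ (a-increasing×coloured j<i)))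

  open Ramsey using (ramsey)

  opaque
    ordered-ramsey : {p : Subset} (c : ℕ → ℕ → Bool) → Infinite p →
      Σ Subset λ q → Infinite q × q ⊆ p × OrderColoured c q
    ordered-ramsey c p-inf with ramsey c p-inf
    ... | q₁ , q₁-inf , q₁⊆p , β< , mono< with ramsey (flip c) q₁-inf
    ... | q₂ , q₂-inf , q₂⊆q₁ , β> , mono> with infinite-pigeonhole (λ x → c x x) q₂-inf
    ... | β= , q₃-inf = _ , q₃-inf , q₁⊆p ∘ q₂⊆q₁ ∘ proj₁ , H , coloured
      where
      H : Order → Bool
      H less    = β<
      H equal   = β=
      H greater = β>

      coloured : ∀ {a b} → q₂ a × c a a ≡ β= → q₂ b × c b b ≡ β= → c a b ≡ H (order a b)
      coloured {a} {b} (a∈q₂ , diag) (b∈q₂ , _) with <-cmp a b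
      ... | tri< a<b _ _ rewrite order-< a<b = mono< (q₂⊆q₁ a∈q₂) (q₂⊆q₁ b∈q₂) a<b
      ... | tri≈ _ refl _ rewrite order-refl a = diag
      ... | tri> _ _ b<a rewrite order-> b<a = mono> b∈q₂ a∈q₂ b<a

  colouring : Rel ℕ 0ℓ → ℕ → ℕ → Bool
  colouring ρ a b = does (em {ρ a b})

  order-coloured⇒invariant : {ρ : Rel ℕ 0ℓ} {q : Subset} →
    OrderColoured (colouring ρ) q → OrderInvariantOn ρ q
  order-coloured⇒invariant {ρ} (H , coloured) {a} {b} {a′} {b′} a∈q b∈q a′∈q b′∈q e r =
    does-true⇒ em (begin
      colouring ρ a′ b′  ≡⟨ coloured a′∈q b′∈q ⟩
      H (order a′ b′)    ≡⟨ cong H e ⟨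
      H (order a b)      ≡⟨ coloured a∈q b∈q ⟨
      colouring ρ a b    ≡⟨ dec-true em r ⟩
      true               ∎)
    where open ≡-Reasoning

  order-invariant-subset : {p : Subset} (ρ : Rel ℕ 0ℓ) → Infinite p →
    Σ Subset λ q → Infinite q × q ⊆ p × OrderInvariantOn ρ q
  order-invariant-subset ρ p-inf with ordered-ramsey (colouring ρ) p-inf
  ... | q , q-inf , q⊆p , coloured = q , q-inf , q⊆p , order-coloured⇒invariant coloured

  -- f := g⁻¹ ∘ σ ∘ g, where σ is the order isomorphism from the range of g onto g[A]
  module Transport {ρ : Rel ℕ 0ℓ} {g : ℕ → ℕ} {A : Subset} (g-inj : Injective _≡_ _≡_ g)
    (g-det : OrderDeterminedBy ρ g) (A-inf : Infinite A) where

    module R  = Rank (decidable (Image g U)) (image-infinite g-inj U-infinite)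
    module Rₐ = Rank (decidable (Image g A)) (image-infinite g-inj A-inf)

    σ : ℕ → ℕ
    σ = Rₐ.enum ∘ R.rank

    order-σ : Image g U d → Image g U d′ → order (σ d) (σ d′) ≡ order d d′
    order-σ d∈R d′∈R = trans
      (strictMonoOn⇒order-preserving {D = U} (λ _ _ → Rₐ.enum-strict) tt tt)
      (strictMonoOn⇒order-preserving (λ x∈R _ → R.rank-strict x∈R) d∈R d′∈R)

    f : ℕ → ℕ
    f x = proj₁ (Rₐ.enum-∈ (R.rank (g x)))

    f-∈ : ∀ x → A (f x)
    f-∈ x = proj₁ (proj₂ (Rₐ.enum-∈ (R.rank (g x))))

    g∘f : ∀ x → g (f x) ≡ σ (g x)
    g∘f x = proj₂ (proj₂ (Rₐ.enum-∈ (R.rank (g x))))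

    order-f : ∀ x y → order (g (f x)) (g (f y)) ≡ order (g x) (g y)
    order-f x y = trans (cong₂ order (g∘f x) (g∘f y)) (order-σ (x , tt , refl) (y , tt , refl))

    f-injective : Injective _≡_ _≡_ f
    f-injective {x} {y} fx≡fy = g-inj (order-≡⇒≡ (order-f x y) (cong g fx≡fy))

    f-ρ : ∀ x y → ρ x y ⇔ ρ (f x) (f y)
    f-ρ x y = mk⇔ (g-det (sym (order-f x y))) (g-det (order-f x y))

    f-onto : ∀ {a} → A a → ∃ λ x → f x ≡ a
    f-onto {a} a∈A = x , g-inj (begin
      g (f x)                      ≡⟨ g∘f x ⟩
      Rₐ.enum (R.rank (g x))       ≡⟨ cong (Rₐ.enum ∘ R.rank) gx≡enum-k ⟩
      Rₐ.enum (R.rank (R.enum k))  ≡⟨ cong Rₐ.enum (R.rank-enum k) ⟩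
      Rₐ.enum k                    ≡⟨ Rₐ.enum-rank (a , a∈A , refl) ⟩
      g a                          ∎)
      where
      open ≡-Reasoning
      k : ℕ
      k = Rₐ.rank (g a)
      x : ℕ
      x = proj₁ (R.enum-∈ k)
      gx≡enum-k : g x ≡ R.enum k
      gx≡enum-k = proj₂ (proj₂ (R.enum-∈ k))

    copy : ℙ ρ A
    copy = f , (f-injective , f-ρ) , λ a → mk⇔ f-onto λ { (x , refl) → f-∈ x }

  determined⇒all-infinite-are-copies : {ρ : Rel ℕ 0ℓ} {g : ℕ → ℕ} →
    Injective _≡_ _≡_ g → OrderDeterminedBy ρ g → Infinite A → ℙ ρ A
  determined⇒all-infinite-are-copies = Transport.copy

  somewhere-dense⇒all-infinite-are-copies : {ρ : Rel ℕ 0ℓ} →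
    SomewhereDense (ℙ ρ) → ∀ A → ℙ ρ A ⇔ Infinite A
  somewhere-dense⇒all-infinite-are-copies {ρ} (p , p-inf , dense) A
    with order-invariant-subset ρ p-inf
  ... | q , q-inf , q⊆p , invariant with dense q q-inf q⊆p
  ... | s , (g , g-emb , g-onto) , s⊆q =
    mk⇔ ℙ⇒Infinite (determined⇒all-infinite-are-copies (proj₁ g-emb) g-det)
    where
    g-det : OrderDeterminedBy ρ g
    g-det = embedding-into-invariant⇒determined g-emb
      (λ n → s⊆q (from (g-onto (g n)) (n , refl))) invariant

  all-infinite-are-copies⇒𝓘≡Fin : {ρ : Rel ℕ 0ℓ} → (∀ A → ℙ ρ A ⇔ Infinite A) →
    ∀ I → 𝓘 ρ I ⇔ Lift (Level.suc 0ℓ) (Finite I)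
  all-infinite-are-copies⇒𝓘≡Fin all I = mk⇔
    (λ I∈𝓘 → lift (decidable-stable em λ ¬fin →
      I∈𝓘 (I , from (all I) (¬Finite⇒Infinite ¬fin) , λ i∈I → i∈I)))
    (λ { (lift (N , bound)) (A , A-copy , A⊆I) →
      Finite⇒¬Infinite (N , λ m → bound m ∘ A⊆I) (ℙ⇒Infinite A-copy) })

nowhere-dense⇒tall : DoubleNegationElimination (Level.suc 0ℓ) → {S : Subset → Set} →
  NowhereDense S → Tall (λ I → ¬ (Σ Subset λ A → S A × A ⊆ I))
nowhere-dense⇒tall dne {S} nowhere-dense T T-inf =
  dne λ no-member → nowhere-dense (T , T-inf , dense-below-T no-member)
  where
  dense-below-T : ¬ (Σ Subset λ I → ¬ (Σ Subset λ A → S A × A ⊆ I) × Infinite I × I ⊆ T) →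
    ∀ q → Infinite q → q ⊆ T → Σ Subset λ A → S A × A ⊆ q
  dense-below-T no-member q q-inf q⊆T = dne λ no-copy → no-member (q , no-copy , q-inf , q⊆T)

-- Indivisibility is what makes 𝓘 ρ an ideal; tallness alone follows from (a).
corollary6p2 : ExcludedMiddle (Level.suc 0ℓ) → (ρ : Rel ℕ 0ℓ) →
    ((∀ A → ℙ ρ A ⇔ Infinite A) ⊎ NowhereDense (ℙ ρ))
    × (Indivisible ρ →
       ((∀ I → 𝓘 ρ I ⇔ Lift (Level.suc 0ℓ) (Finite I)) ⊎ Tall (𝓘 ρ)))
corollary6p2 em ρ =
  part-a , λ _ → Sum.map all-infinite-are-copies⇒𝓘≡Fin (nowhere-dense⇒tall dne) part-a
  where
  open Classical (lower-em em)
  dne : DoubleNegationElimination (Level.suc 0ℓ)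
  dne = em⇒dne em

  part-a : (∀ A → ℙ ρ A ⇔ Infinite A) ⊎ NowhereDense (ℙ ρ)
  part-a with em {NowhereDense (ℙ ρ)}
  ... | yes nowhere-dense = inj₂ nowhere-dense
  ... | no somewhere-dense = inj₁ (somewhere-dense⇒all-infinite-are-copies (dne somewhere-dense))
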